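{- Let $X$ be a limit finite set and let $f : X \to {}^*\mathbb{N}$ be an almost bounded limit function. Then there exists a dense subset of $X$ on which $f$ is constant and equal to a standard natural number.
   Context: Fix a non-principal ultrafilter $p$ on $\mathbb{N}$. A limit finite set is an ultraproduct $X=\prod_{n\to p}X_n$ of finite sets (sequences modulo agreement on a set in $p$), with limit cardinality $|X| := \lim_{n\to p}|X_n|$; a limit subset is an ultraproduct of subsets; a limit function is an ultralimit of functions; ${}^*\mathbb{N}$ is the ultrapower of $\mathbb{N}$, and elements of $\mathbb{N}$ (constant sequences) are standard. For limit reals, $|A| \gg |B|$ means $|B| \le C|A|$ for a standard $C$, and $A = o(B)$ means $|A| \le cB$ for every standard $c>0$. A dense subset of $X$ is a limit subset $H$ with $|H|\gg|X|$. A limit subset $H$ is co-sparse if $|X\setminus H| = o(|X|)$. $f$ is almost bounded if there is a co-sparse subset on which $f(x)$ is bounded (i.e. $f(x) \le C_x$ for some standard $C_x$). -}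

module Defs where

open import Data.Nat using (ℕ; suc; _*_; _≤ᵇ_; _≡ᵇ_)
open import Data.Bool using (Bool; true; false; not; _∧_)
open import Data.Maybe using (Maybe; maybe)
open import Data.Fin using (Fin)
open import Data.Fin.Subset using (Subset; ∣_∣; ∁)
open import Data.Vec using (lookup)
open import Data.Product using (Σ; ∃; _×_)
open import Data.Sum using (_⊎_)
open import Relation.Nullary using (¬_)
open import Relation.Binary.PropositionalEquality using (_≡_)

BSet : Set
BSet = ℕ → Bool

-- A non-principal ultrafilter p on ℕ; `Large A` means A ∈ p.
record Ultrafilter : Set₁ where
  field
    Large        : BSet → Set
    full         : Large (λ _ → true)
    proper       : ¬ Large (λ _ → false)
    upward       : ∀ {A B} → (∀ n → A n ≡ true → B n ≡ true) → Large A → Large B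
    inter        : ∀ {A B} → Large A → Large B → Large (λ n → A n ∧ B n)
    ultra        : ∀ A → Large A ⊎ Large (λ n → not (A n))
    nonPrincipal : ∀ m → ¬ Large (λ n → n ≡ᵇ m)

-- A limit finite set X = ∏_{n→p} Fin (N n), given by the sizes N n.
LimitFiniteSet : Set
LimitFiniteSet = ℕ → ℕ

-- An element of X: a sequence x_n ∈ X_n, only required to be defined
-- on some index set (nothing = undefined); it is a genuine element of the
-- ultraproduct when it is defined on a set in p.
LimitElem : LimitFiniteSet → Set
LimitElem N = (n : ℕ) → Maybe (Fin (N n))

LimitSubset : LimitFiniteSet → Set
LimitSubset N = (n : ℕ) → Subset (N n)

-- A limit function f : X → *ℕ, the ultralimit of f_n : X_n → ℕ.
LimitFunction : LimitFiniteSet → Set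
LimitFunction N = (n : ℕ) → Fin (N n) → ℕ

at : ∀ {m} → Maybe (Fin m) → (Fin m → Bool) → Bool
at x P = maybe P false x

module _ (p : Ultrafilter) where
  open Ultrafilter p

  _∈ₗ_ : ∀ {N} → LimitElem N → LimitSubset N → Set
  x ∈ₗ H = Large (λ n → at (x n) (lookup (H n)))

  Dense : (N : LimitFiniteSet) → LimitSubset N → Set
  Dense N H = ∃ λ (C : ℕ) → Large (λ n → N n ≤ᵇ C * ∣ H n ∣)

  -- H co-sparse: |X \ H| ≤ c |X| for every standard rational c = (a+1)/(b+1) > 0.
  CoSparse : (N : LimitFiniteSet) → LimitSubset N → Set
  CoSparse N H = ∀ (a b : ℕ) → Large (λ n → suc b * ∣ ∁ (H n) ∣ ≤ᵇ suc a * N n)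

  BoundedAt : ∀ {N} → LimitFunction N → LimitElem N → Set
  BoundedAt f x = ∃ λ (C : ℕ) → Large (λ n → at (x n) (λ i → f n i ≤ᵇ C))

  AlmostBounded : (N : LimitFiniteSet) → LimitFunction N → Set
  AlmostBounded N f =
    Σ (LimitSubset N) λ H → CoSparse N H × (∀ x → x ∈ₗ H → BoundedAt f x)

  ConstantOn : ∀ {N} → LimitFunction N → LimitSubset N → ℕ → Set
  ConstantOn f H k = ∀ x → x ∈ₗ H → Large (λ n → at (x n) (λ i → f n i ≡ᵇ k))

module Submission where

-- Let H be the co-sparse limit subset on which f is bounded.
-- If X_n is empty for p-almost all n, every limit subset is dense and any
-- level set of f will do.  Otherwise, for p-almost all n the set X_n is
-- nonempty and H_n fills at least half of it; let x_n be a point of H_n at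
-- which f_n is maximal on H_n.  Then x ∈ H, so f(x) ≤ C for a standard C,
-- hence f_n ≤ C on all of H_n.  The at most C+1 level sets {f_n = k},
-- k ≤ C, cover H_n, so one of them has at least |X_n| / (2(C+1)) elements
-- (pigeonhole).  The index k may depend on n, but it ranges over a finite
-- set, so the ultrafilter picks a single standard k for p-almost all n.

open import Defs
open import Algebra.Properties.CommutativeSemigroup using (interchange)
open import Data.Bool using (Bool; true; false; not; _∧_)
open import Data.Bool.Properties using (T-≡)
open import Data.Empty using (⊥; ⊥-elim)
open import Data.Fin using (Fin; zero; suc)
open import Data.Fin.Subset using (Subset; ∣_∣; ∁; _∈_; _⊆_; Empty)
open import Data.Fin.Subset.Properties using (Empty-unique; ∣⊥∣≡0; p⊆q⇒∣p∣≤∣q∣; ∣p∣≤n; ∣∁p∣≡n∸∣p∣)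
open import Data.Maybe using (Maybe; just; nothing)
open import Data.Nat using (ℕ; zero; suc; _+_; _*_; _∸_; _≤_; _<_; z≤n; s≤s; _≤ᵇ_; _≡ᵇ_)
open import Data.Nat.Properties
open import Data.Product using (Σ; ∃; _×_; _,_; proj₁; proj₂)
open import Data.Sum using (inj₁; inj₂)
open import Data.Vec using (_∷_; []; lookup; tabulate; here; there)
open import Data.Vec.Properties using (lookup∘tabulate; []=⇒lookup; lookup⇒[]=)
open import Function using (_∘_)
open import Function.Bundles using (Equivalence)
open import Relation.Nullary using (yes; no)
open import Relation.Binary.PropositionalEquality

≤ᵇ-intro : ∀ {m n} → m ≤ n → (m ≤ᵇ n) ≡ true
≤ᵇ-intro m≤n = Equivalence.to T-≡ (≤⇒≤ᵇ m≤n)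

≤ᵇ-elim : ∀ {m n} → (m ≤ᵇ n) ≡ true → m ≤ n
≤ᵇ-elim {m} {n} e = ≤ᵇ⇒≤ m n (Equivalence.from T-≡ e)

≡ᵇ-elim : ∀ {m n} → (m ≡ᵇ n) ≡ true → m ≡ n
≡ᵇ-elim {m} {n} e = ≡ᵇ⇒≡ m n (Equivalence.from T-≡ e)

∧-elim : ∀ {a b} → a ∧ b ≡ true → a ≡ true × b ≡ true
∧-elim {true} {true} _ = refl , refl

not-true : ∀ {b} → b ≡ true → not b ≡ true → ⊥
not-true refl ()

≤ᵇ-suc : ∀ x C → (suc x ≤ᵇ suc C) ≡ (x ≤ᵇ C)
≤ᵇ-suc zero    C = refl
≤ᵇ-suc (suc x) C = refl

⟦_⟧ : Bool → ℕ
⟦ true ⟧  = 1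
⟦ false ⟧ = 0

∣∷∣ : ∀ {m} b (v : Subset m) → ∣ b ∷ v ∣ ≡ ⟦ b ⟧ + ∣ v ∣
∣∷∣ true  v = refl
∣∷∣ false v = refl

Σ≤ : ℕ → (ℕ → ℕ) → ℕ
Σ≤ zero    g = g 0
Σ≤ (suc C) g = g 0 + Σ≤ C (g ∘ suc)

Σ≤-cong : ∀ C {g h : ℕ → ℕ} → (∀ k → g k ≡ h k) → Σ≤ C g ≡ Σ≤ C h
Σ≤-cong zero    g≡h = g≡h 0
Σ≤-cong (suc C) g≡h = cong₂ _+_ (g≡h 0) (Σ≤-cong C (g≡h ∘ suc))

Σ≤-+ : ∀ C (g h : ℕ → ℕ) → Σ≤ C (λ k → g k + h k) ≡ Σ≤ C g + Σ≤ C h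
Σ≤-+ zero    g h = refl
Σ≤-+ (suc C) g h = begin
  (g 0 + h 0) + Σ≤ C (λ k → g (suc k) + h (suc k)) ≡⟨ cong (g 0 + h 0 +_) (Σ≤-+ C (g ∘ suc) (h ∘ suc)) ⟩
  (g 0 + h 0) + (Σ≤ C (g ∘ suc) + Σ≤ C (h ∘ suc))  ≡⟨ interchange +-commutativeSemigroup (g 0) (h 0) _ _ ⟩
  (g 0 + Σ≤ C (g ∘ suc)) + (h 0 + Σ≤ C (h ∘ suc))  ∎
  where open ≡-Reasoning

pigeonhole : ∀ C (g : ℕ → ℕ) → ∃ λ k → k ≤ C × Σ≤ C g ≤ suc C * g k
pigeonhole zero g = 0 , z≤n , ≤-reflexive (sym (+-identityʳ (g 0)))
pigeonhole (suc C) g with pigeonhole C (g ∘ suc)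
... | k , k≤C , bound with g 0 ≤? g (suc k)
...   | yes g0≤ = suc k , s≤s k≤C , +-mono-≤ g0≤ bound
...   | no  g0≰ = 0 , z≤n , +-monoʳ-≤ (g 0) (≤-trans bound (*-monoʳ-≤ (suc C) (<⇒≤ (≰⇒> g0≰))))

indicator-≤ : ∀ x C → ⟦ x ≤ᵇ C ⟧ ≤ Σ≤ C (λ k → ⟦ x ≡ᵇ k ⟧)
indicator-≤ zero    zero    = ≤-refl
indicator-≤ zero    (suc C) = m≤m+n 1 _
indicator-≤ (suc x) zero    = z≤n
indicator-≤ (suc x) (suc C) rewrite ≤ᵇ-suc x C = indicator-≤ x C

level : ∀ {m} → (Fin m → ℕ) → ℕ → Subset m
level f k = tabulate (λ i → f i ≡ᵇ k)

below : ∀ {m} → (Fin m → ℕ) → ℕ → Subset m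
below f C = tabulate (λ i → f i ≤ᵇ C)

-- {f ≤ C} is the union of the level sets {f = k}, k ≤ C.
∣below∣≤Σ∣level∣ : ∀ {m} (f : Fin m → ℕ) C → ∣ below f C ∣ ≤ Σ≤ C (λ k → ∣ level f k ∣)
∣below∣≤Σ∣level∣ {zero}  f C = z≤n
∣below∣≤Σ∣level∣ {suc m} f C = begin
  ∣ below f C ∣                                  ≡⟨ ∣∷∣ (f zero ≤ᵇ C) (below (f ∘ suc) C) ⟩
  ⟦ f zero ≤ᵇ C ⟧ + ∣ below (f ∘ suc) C ∣
    ≤⟨ +-mono-≤ (indicator-≤ (f zero) C) (∣below∣≤Σ∣level∣ (f ∘ suc) C) ⟩
  Σ≤ C (λ k → ⟦ f zero ≡ᵇ k ⟧) + Σ≤ C (λ k → ∣ level (f ∘ suc) k ∣)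
    ≡⟨ Σ≤-+ C (λ k → ⟦ f zero ≡ᵇ k ⟧) (λ k → ∣ level (f ∘ suc) k ∣) ⟨
  Σ≤ C (λ k → ⟦ f zero ≡ᵇ k ⟧ + ∣ level (f ∘ suc) k ∣)
    ≡⟨ Σ≤-cong C (λ k → sym (∣∷∣ (f zero ≡ᵇ k) (level (f ∘ suc) k))) ⟩
  Σ≤ C (λ k → ∣ level f k ∣)                     ∎
  where open ≤-Reasoning

largeLevel : ∀ {m} c (f : Fin m → ℕ) C (H : Subset m) → H ⊆ below f C → m ≤ c * ∣ H ∣ →
  ∃ λ k → k ≤ C × m ≤ (c * suc C) * ∣ level f k ∣
largeLevel {m} c f C H H⊆below m≤ with pigeonhole C (λ k → ∣ level f k ∣)
... | k , k≤C , average = k , k≤C , (begin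
  m                                    ≤⟨ m≤ ⟩
  c * ∣ H ∣                            ≤⟨ *-monoʳ-≤ c (p⊆q⇒∣p∣≤∣q∣ H⊆below) ⟩
  c * ∣ below f C ∣                    ≤⟨ *-monoʳ-≤ c (∣below∣≤Σ∣level∣ f C) ⟩
  c * Σ≤ C (λ k → ∣ level f k ∣)       ≤⟨ *-monoʳ-≤ c average ⟩
  c * (suc C * ∣ level f k ∣)          ≡⟨ *-assoc c (suc C) _ ⟨
  (c * suc C) * ∣ level f k ∣          ∎)
  where open ≤-Reasoning

halfFull : ∀ {m} (H : Subset m) → 2 * ∣ ∁ H ∣ ≤ m → m ≤ 2 * ∣ H ∣
halfFull {m} H small = begin
  m                      ≡⟨ m+[n∸m]≡n (∣p∣≤n H) ⟨
  ∣ H ∣ + (m ∸ ∣ H ∣)    ≤⟨ +-monoʳ-≤ ∣ H ∣ rest≤ ⟩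
  ∣ H ∣ + ∣ H ∣          ≡⟨ cong (∣ H ∣ +_) (+-identityʳ ∣ H ∣) ⟨
  2 * ∣ H ∣              ∎
  where
  open ≤-Reasoning
  rest : ℕ
  rest = m ∸ ∣ H ∣
  -- 2·rest ≤ m = |H| + rest, so rest ≤ |H|
  rest≤ : rest ≤ ∣ H ∣
  rest≤ = +-cancelʳ-≤ rest rest ∣ H ∣ (begin
    rest + rest            ≡⟨ cong (rest +_) (+-identityʳ rest) ⟨
    2 * rest               ≡⟨ cong (2 *_) (∣∁p∣≡n∸∣p∣ H) ⟨
    2 * ∣ ∁ H ∣            ≤⟨ small ⟩
    m                      ≡⟨ m+[n∸m]≡n (∣p∣≤n H) ⟨
    ∣ H ∣ + rest           ∎)

positiveHalf : ∀ {m h} → m ≤ 2 * h → not (m ≡ᵇ 0) ≡ true → 0 < h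
positiveHalf {zero}          _  ()
positiveHalf {suc m} {zero}  ()
positiveHalf {suc m} {suc h} _  _ = s≤s z≤n

data MaxOn {m} (H : Subset m) (f : Fin m → ℕ) : Set where
  empty : Empty H → MaxOn H f
  maxAt : (i : Fin m) → i ∈ H → (∀ {j} → j ∈ H → f j ≤ f i) → MaxOn H f

maxOn : ∀ {m} (H : Subset m) (f : Fin m → ℕ) → MaxOn H f
maxOn [] f = empty λ ()
maxOn (false ∷ H) f with maxOn H (f ∘ suc)
... | empty none       = empty λ { (suc j , there j∈H) → none (j , j∈H) }
... | maxAt i i∈H max  = maxAt (suc i) (there i∈H) λ { (there j∈H) → max j∈H }
maxOn (true ∷ H) f with maxOn H (f ∘ suc)
... | empty none      = maxAt zero here λ { here → ≤-refl ; (there j∈H) → ⊥-elim (none (_ , j∈H)) }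
... | maxAt i i∈H max with f zero ≤? f (suc i)
...   | yes f0≤ = maxAt (suc i) (there i∈H) λ { here → f0≤ ; (there j∈H) → max j∈H }
...   | no  f0≰ = maxAt zero here λ { here → ≤-refl ; (there j∈H) → ≤-trans (max j∈H) (<⇒≤ (≰⇒> f0≰)) }

point : ∀ {m} {H : Subset m} {f : Fin m → ℕ} → MaxOn H f → Maybe (Fin m)
point (empty _)     = nothing
point (maxAt i _ _) = just i

point∈ : ∀ {m} {H : Subset m} {f : Fin m → ℕ} (v : MaxOn H f) → 0 < ∣ H ∣ → at (point v) (lookup H) ≡ true
point∈ {m} (empty none) 0<∣H∣ = ⊥-elim (<-irrefl (sym (trans (cong ∣_∣ (Empty-unique none)) (∣⊥∣≡0 m))) 0<∣H∣)
point∈ (maxAt i i∈H _) _      = []=⇒lookup i∈H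

point-bounds : ∀ {m} {H : Subset m} {f : Fin m → ℕ} C (v : MaxOn H f) →
  at (point v) (λ i → f i ≤ᵇ C) ≡ true → H ⊆ below f C
point-bounds C (empty _) ()
point-bounds C (maxAt i i∈H max) fi≤C {j} j∈H =
  lookup⇒[]= j _ (trans (lookup∘tabulate _ j) (≤ᵇ-intro (≤-trans (max j∈H) (≤ᵇ-elim fi≤C))))

module _ (p : Ultrafilter) where
  open Ultrafilter p

  -- If for p-almost all n one of the sets B 0 n, …, B C n holds, then one
  -- of B 0, …, B C is in p: an ultrafilter is prime for finite unions.
  chooseIndex : ∀ C (B : ℕ → BSet) {A : BSet} → Large A →
    (∀ n → A n ≡ true → ∃ λ k → k ≤ C × B k n ≡ true) → ∃ λ k → Large (B k)
  chooseIndex zero B {A} largeA cover = 0 , upward indexZero largeA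
    where
    indexZero : ∀ n → A n ≡ true → B 0 n ≡ true
    indexZero n a with cover n a
    ... | .0 , z≤n , b = b
  chooseIndex (suc C) B {A} largeA cover with ultra (B (suc C))
  ... | inj₁ largeB = suc C , largeB
  ... | inj₂ smallB = chooseIndex C B (inter largeA smallB) coverBelow
    where
    coverBelow : ∀ n → A n ∧ not (B (suc C) n) ≡ true → ∃ λ k → k ≤ C × B k n ≡ true
    coverBelow n e with ∧-elim e
    ... | a , notB with cover n a
    ...   | k , k≤ , b with m≤n⇒m<n∨m≡n k≤
    ...     | inj₁ k< = k , ≤-pred k< , b
    ...     | inj₂ refl = ⊥-elim (not-true b notB)

  levelSet : ∀ {N} → LimitFunction N → ℕ → LimitSubset N
  levelSet f k n = level (f n) k

  levelSet-constant : ∀ {N} (f : LimitFunction N) k → ConstantOn p f (levelSet f k) k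
  levelSet-constant f k x x∈level = upward (λ n → at-level {g = f n} (x n)) x∈level
    where
    at-level : ∀ {m} {g : Fin m → ℕ} (y : Maybe (Fin m)) →
      at y (lookup (level g k)) ≡ true → at y (λ i → g i ≡ᵇ k) ≡ true
    at-level nothing  ()
    at-level (just i) e = trans (sym (lookup∘tabulate _ i)) e

  dense-if-empty : ∀ {N} → Large (λ n → N n ≡ᵇ 0) → (H : LimitSubset N) → Dense p N H
  dense-if-empty {N} emptyX H = 0 , upward (λ n e → ≤ᵇ-intro {N n} {0} (≤-reflexive (≡ᵇ-elim e))) emptyX

  someLevelDense : ∀ {N} (f : LimitFunction N) (H : LimitSubset N) → CoSparse p N H →
    (∀ x → _∈ₗ_ p x H → BoundedAt p f x) → Large (λ n → not (N n ≡ᵇ 0)) →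
    ∃ λ k → Dense p N (levelSet f k)
  someLevelDense {N} f H coSparse bounded nonemptyX =
    let C , fx≤C = bounded x x∈H
        k , dense = chooseIndex C (λ k n → N n ≤ᵇ (2 * suc C) * ∣ levelSet f k n ∣)
                      {λ n → good n ∧ at (x n) (λ i → f n i ≤ᵇ C)}
                      (inter good-ae fx≤C) (levelAt C)
    in k , 2 * suc C , dense
    where
    -- Good indices: X_n ≠ ∅ and |X_n \ H_n| ≤ |X_n| / 2.  They form a set in p
    -- by co-sparseness of H (with ratio 1/2).
    good : BSet
    good n = not (N n ≡ᵇ 0) ∧ (2 * ∣ ∁ (H n) ∣ ≤ᵇ 1 * N n)

    good-ae : Large good
    good-ae = inter nonemptyX (coSparse 0 1)

    halfFull-at : ∀ n → good n ≡ true → N n ≤ 2 * ∣ H n ∣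
    halfFull-at n e = halfFull (H n) (subst (2 * ∣ ∁ (H n) ∣ ≤_) (*-identityˡ (N n)) (≤ᵇ-elim (proj₂ (∧-elim e))))

    x : LimitElem N
    x n = point (maxOn (H n) (f n))

    x∈H : _∈ₗ_ p x H
    x∈H = upward (λ n e → point∈ (maxOn (H n) (f n)) (positiveHalf (halfFull-at n e) (proj₁ (∧-elim e)))) good-ae

    levelAt : ∀ C n → good n ∧ at (x n) (λ i → f n i ≤ᵇ C) ≡ true →
      ∃ λ k → k ≤ C × (N n ≤ᵇ (2 * suc C) * ∣ levelSet f k n ∣) ≡ true
    levelAt C n e with ∧-elim e
    ... | isGood , fx≤C with largeLevel 2 (f n) C (H n) (point-bounds C (maxOn (H n) (f n)) fx≤C) (halfFull-at n isGood)
    ...   | k , k≤C , bound = k , k≤C , ≤ᵇ-intro bound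

lemmaA9 : (p : Ultrafilter) (N : LimitFiniteSet) (f : LimitFunction N)
    → AlmostBounded p N f
    → Σ (LimitSubset N) λ H → Dense p N H × ∃ λ (k : ℕ) → ConstantOn p f H k
lemmaA9 p N f (H , coSparse , bounded) with Ultrafilter.ultra p (λ n → N n ≡ᵇ 0)
... | inj₁ emptyX    = levelSet p f 0 , dense-if-empty p emptyX (levelSet p f 0) , 0 , levelSet-constant p f 0
... | inj₂ nonemptyX =
  let k , dense = someLevelDense p f H coSparse bounded nonemptyX
  in levelSet p f k , dense , k , levelSet-constant p f k
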